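{- Let $(M,\nu,\mathfrak{e})$, $(\mathscr{O},\eta,e)$, $\tau$ form a $c$-monop. Let $(m_1,a_1),(m_2,a_2),(m_3,a_3)$ be nested elements: $(m_1,a_1)\in M[V_1]\times E(\mathscr{O})[V_2]\subseteq (M\cdot E(\mathscr{O}))[V]$ with $V=V_1+V_2$; $(m_2,a_2)\in M[\pi_1]\times E(\mathscr{O})[\pi_2]$ where $\pi=\pi_1+\pi_2$ is a splitting of the partition $\pi$ underlying $a_1$; $(m_3,a_3)\in M[\varsigma_1]\times E(\mathscr{O})[\varsigma_2]$ where $\varsigma=\varsigma_1+\varsigma_2$ is a splitting of the partition $\varsigma$ underlying $a_2$. Then: (1) (associativity) $\bar\rho(\bar\rho((m_1,a_1),(m_2,a_2)),(m_3,a_3))=\bar\rho((m_1,a_1),\bar\rho((m_2,a_2),(m_3,a_3)))$; (2) (left cancellation) if $\bar\rho((m_1,a_1),(m_2,a_2))=\bar\rho((m_1,a_1),(m_2',a_2'))$ then $(m_2,a_2)=(m_2',a_2')$; (3) (no proper divisors of the identity) if $\bar\rho((m_1,a_1),(m_2,a_2))=(\mathfrak{e},\{e_v\}_{v\in V})$, then $m_1=m_2=\mathfrak{e}$ and $a_1=a_2$ are the assemblies of identity singletons.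
   Context: Species are functors from finite sets with bijections to finite sets; positive means $F[\emptyset]=\emptyset$; sums are disjoint unions. Product $(M\cdot N)[V]=\sum_{V_1+V_2=V}M[V_1]\times N[V_2]$. For positive $P$, $R(P)[V]=\sum_\pi(\prod_{B\in\pi}P[B])\times R[\pi]$ over partitions $\pi$ of $V$; elements are pairs $(a,r)$ with $a=\{p_B\}_{B\in\pi}$ an assembly of $P$-structures. $E(P)[V]$ is the set of all assemblies of $P$-structures on $V$ (only the empty assembly if $V=\emptyset$). Monoid $(M,\nu,\mathfrak e)$: $\nu:M\cdot M\to M$ associative with two-sided unit $\mathfrak e\in M[\emptyset]$. Operad $(\mathscr O,\eta,e)$: $\mathscr O$ positive, $\eta:\mathscr O(\mathscr O)\to\mathscr O$, $e_v\in\mathscr O[\{v\}]$; for an assembly $a=\{\omega_C\}_{C\in\pi}$ on $V$ and an assembly $b=\{w_D\}_{D\in\sigma}$ on the set $\pi$, $\bar\eta(a,b)=\{\eta(\{\omega_C\}_{C\in D},w_D)\}_{D\in\sigma}$ (assembly on $V$ with partition identified with $\sigma$); axioms $\eta(\bar\eta(a,b),\omega)=\eta(a,\eta(b,\omega))$, $\eta(\{e_v\}_{v\in V},\omega)=\omega=\eta(\{\omega\},e_V)$. Right module: $\tau:M(\mathscr O)\to M$ with $\tau(\bar\eta(a,b),m)=\tau(a,\tau(b,m))$ and $\tau(\{e_v\}_{v\in V},m)=m$. Compatibility: $\nu(\tau(a_1,m_1),\tau(a_2,m_2))=\tau(a_1\sqcup a_2,\nu(m_1,m_2))$ for disjoint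 supports. A $c$-monop is such data ($M$ a monoid and right $\mathscr O$-module with $\nu,\tau$ compatible, so that $(M,\mathscr O)$ is a monop with $\rho=\nu\circ(M\cdot\tau)$) with in addition: $|M[\emptyset]|=1$; $\nu(m_1,m_2)=\nu(m_1,m_2')\Rightarrow m_2=m_2'$; $|\mathscr O[\{v\}]|=1$ for every singleton; $\eta(a,\omega)=\eta(a,\omega')\Rightarrow\omega=\omega'$; and $\tau(a,m)=\tau(a,m')\Rightarrow m=m'$. Product $\bar\rho$: for $(m_1,a_1)\in M[V_1]\times E(\mathscr O)[V_2]$ with $a_1$ having underlying partition $\pi$, and $(m_2',a_2')\in M[\pi_1]\times E(\mathscr O)[\pi_2]$ for a splitting $\pi=\pi_1+\pi_2$ (either part may be empty), let $a_1^{(i)}$ be the subassembly of $a_1$ with underlying partition $\pi_i$, and set $\bar\rho((m_1,a_1),(m_2',a_2'))=(\nu(m_1,\tau(a_1^{(1)},m_2')),\bar\eta(a_1^{(2)},a_2'))$. -}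

module Defs where

open import Data.Nat.Base
  using (ℕ; zero; suc; _+_; _<_; _≤_; _<ᵇ_; _≡ᵇ_; ⌊_/2⌋; z≤n; s≤s; _⊔_)
open import Data.Nat.Properties
  using (<ᵇ⇒<; <⇒<ᵇ; ≡ᵇ⇒≡; ≡⇒≡ᵇ; ≤-trans; ≤-refl; <⇒≤; m<1+n⇒m<n∨m≡n;
         m≤m+n; m≤n+m; m≤m⊔n; m≤n⊔m; <-≤-trans)
open import Data.Bool.Base using (Bool; true; false; T; _∧_; _∨_; if_then_else_)
open import Data.Bool.Properties using (T-∧; T-∨)
open import Data.Unit.Base using (tt)
open import Data.Product.Base using (Σ; _×_; _,_; proj₁; proj₂)
open import Data.Sum.Base using (_⊎_; inj₁; inj₂)
open import Data.Empty using (⊥; ⊥-elim)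
open import Function.Bundles using (Equivalence)
open import Relation.Binary.PropositionalEquality
  using (_≡_; refl; sym; trans; cong; subst)

-- 1. Hereditarily finite sets, coded by natural numbers (Ackermann coding)
--
-- A natural number A codes the finite set of all x with bit x of A set.
-- Every finite set of such codes is again coded by a unique natural number,
-- so this gives a (canonical) universe of finite sets closed under forming
-- finite sets of its elements: sets of blocks, sets of sets of blocks, ...
-- Equality of sets is propositional equality of codes.

odd : ℕ → Bool
odd zero = false
odd (suc zero) = true
odd (suc (suc n)) = odd n

testBit : ℕ → ℕ → Bool
testBit n zero = odd n
testBit n (suc x) = testBit ⌊ n /2⌋ x

infix 4 _∈_
-- x ∈ A  iff bit x of A is set (wrapped in a record for type inference)
record _∈_ (x A : ℕ) : Set where
  constructor mem
  field unmem : T (testBit A x)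
open _∈_ public

∅ : ℕ
∅ = 0

double : ℕ → ℕ
double zero = zero
double (suc n) = suc (suc (double n))

setOf : ℕ → (ℕ → Bool) → ℕ
setOf zero p = zero
setOf (suc b) p =
  (if p 0 then suc else (λ n → n)) (double (setOf b (λ x → p (suc x))))

any< : ℕ → (ℕ → Bool) → Bool
any< zero p = false
any< (suc b) p = any< b p ∨ p b

search : ℕ → (ℕ → Bool) → ℕ
search zero p = zero
search (suc b) p = if p b then b else search b p

max< : ℕ → (ℕ → ℕ) → ℕ
max< zero f = zero
max< (suc b) f = max< b f ⊔ f b

private
  half-double : ∀ k → ⌊ double k /2⌋ ≡ k
  half-double zero = refl
  half-double (suc k) = cong suc (half-double k)

  half-sdouble : ∀ k → ⌊ suc (double k) /2⌋ ≡ k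
  half-sdouble zero = refl
  half-sdouble (suc k) = cong suc (half-sdouble k)

  odd-double : ∀ k → odd (double k) ≡ false
  odd-double zero = refl
  odd-double (suc k) = odd-double k

  odd-sdouble : ∀ k → odd (suc (double k)) ≡ true
  odd-sdouble zero = refl
  odd-sdouble (suc k) = odd-sdouble k

  half≤ : ∀ n → ⌊ n /2⌋ ≤ n
  half≤ zero = z≤n
  half≤ (suc zero) = z≤n
  half≤ (suc (suc n)) = s≤s (≤-trans (half≤ n) (<⇒≤ (s≤s ≤-refl)))

  half-lt : ∀ n x → x < ⌊ n /2⌋ → suc x < n
  half-lt zero x ()
  half-lt (suc zero) x ()
  half-lt (suc (suc n)) x (s≤s x≤h) = s≤s (s≤s (≤-trans x≤h (half≤ n)))

testBit-0 : ∀ x → testBit 0 x ≡ false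
testBit-0 zero = refl
testBit-0 (suc x) = testBit-0 x

testBit-setOf : ∀ b p x → testBit (setOf b p) x ≡ ((x <ᵇ b) ∧ p x)
testBit-setOf zero p x = testBit-0 x
testBit-setOf (suc b) p zero with p 0
... | true = odd-sdouble (setOf b (λ x → p (suc x)))
... | false = odd-double (setOf b (λ x → p (suc x)))
testBit-setOf (suc b) p (suc x) with p 0
... | true  = trans (cong (λ n → testBit n x) (half-sdouble (setOf b (λ y → p (suc y)))))
                   (testBit-setOf b (λ y → p (suc y)) x)
... | false = trans (cong (λ n → testBit n x) (half-double (setOf b (λ y → p (suc y)))))
                   (testBit-setOf b (λ y → p (suc y)) x)

∈-setOf⁺ : ∀ {b : ℕ} {p : ℕ → Bool} {x : ℕ} → x < b → T (p x) → x ∈ setOf b p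
∈-setOf⁺ {b} {p} {x} x<b px =
  mem (subst T (sym (testBit-setOf b p x)) (Equivalence.from T-∧ (<⇒<ᵇ x<b , px)))

∈-setOf⁻ : ∀ {b : ℕ} {p : ℕ → Bool} {x : ℕ} → x ∈ setOf b p → x < b × T (p x)
∈-setOf⁻ {b} {p} {x} (mem h) with Equivalence.to T-∧ (subst T (testBit-setOf b p x) h)
... | (lt , px) = <ᵇ⇒< x b lt , px

∈⇒< : ∀ {x n} → x ∈ n → x < n
∈⇒< {zero} {zero} (mem ())
∈⇒< {zero} {suc n} h = s≤s z≤n
∈⇒< {suc x} {n} (mem h) = half-lt n x (∈⇒< {x} {⌊ n /2⌋} (mem h))

any<⁺ : ∀ {b : ℕ} {p : ℕ → Bool} {y : ℕ} → y < b → T (p y) → T (any< b p)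
any<⁺ {suc b} {p} {y} y<b py with m<1+n⇒m<n∨m≡n y<b
... | inj₁ y<b' = Equivalence.from T-∨ (inj₁ (any<⁺ y<b' py))
... | inj₂ refl = Equivalence.from T-∨ (inj₂ py)

any<⁻ : ∀ {b : ℕ} {p : ℕ → Bool} → T (any< b p) → Σ ℕ (λ y → y < b × T (p y))
any<⁻ {suc b} {p} h with Equivalence.to T-∨ h
... | inj₁ h' with any<⁻ {b} {p} h'
...   | (y , y<b , py) = y , ≤-trans y<b (<⇒≤ (s≤s ≤-refl)) , py
any<⁻ {suc b} {p} h | inj₂ pb = b , s≤s ≤-refl , pb

search-sound : ∀ {b : ℕ} {p : ℕ → Bool} {y : ℕ} → y < b → T (p y) → T (p (search b p))
search-sound {suc b} {p} {y} y<b py with p b in eq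
... | true = subst T (sym eq) tt
... | false with m<1+n⇒m<n∨m≡n y<b
...   | inj₁ y<b' = search-sound y<b' py
...   | inj₂ refl = ⊥-elim (subst T eq py)

max<-bound : ∀ {b : ℕ} {f : ℕ → ℕ} {y : ℕ} → y < b → f y ≤ max< b f
max<-bound {suc b} {f} {y} y<b with m<1+n⇒m<n∨m≡n y<b
... | inj₁ y<b' = ≤-trans (max<-bound y<b') (m≤m⊔n (max< b f) (f b))
... | inj₂ refl = m≤n⊔m (max< b f) (f b)

⟨_⟩ : ℕ → ℕ
⟨ v ⟩ = setOf (suc v) (λ x → x ≡ᵇ v)

infixr 6 _∪_
_∪_ : ℕ → ℕ → ℕ
A ∪ B = setOf (A + B) (λ x → testBit A x ∨ testBit B x)

⋃ : ℕ → ℕ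
⋃ π = setOf π (λ x → any< π (λ B → testBit π B ∧ testBit B x))

image : ℕ → (ℕ → ℕ) → ℕ
image X h = setOf (suc (max< X h)) (λ y → any< X (λ D → testBit X D ∧ (h D ≡ᵇ y)))

NonEmpty : ℕ → Set
NonEmpty B = T (any< B (testBit B))

∉∅ : ∀ {x} → x ∈ ∅ → ⊥
∉∅ {x} (mem h) = subst T (testBit-0 x) h

∈⟨⟩⁺ : ∀ v → v ∈ ⟨ v ⟩
∈⟨⟩⁺ v = ∈-setOf⁺ {suc v} {λ x → x ≡ᵇ v} {v} (s≤s ≤-refl) (≡⇒≡ᵇ v v refl)

∈⟨⟩⁻ : ∀ {v x} → x ∈ ⟨ v ⟩ → x ≡ v
∈⟨⟩⁻ {v} {x} h = ≡ᵇ⇒≡ x v (proj₂ (∈-setOf⁻ {suc v} {λ y → y ≡ᵇ v} {x} h))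

∈∪⁺ˡ : ∀ {A B x} → x ∈ A → x ∈ A ∪ B
∈∪⁺ˡ {A} {B} {x} h =
  ∈-setOf⁺ {A + B} {λ y → testBit A y ∨ testBit B y} {x} (<-≤-trans (∈⇒< h) (m≤m+n A B)) (Equivalence.from T-∨ (inj₁ (unmem h)))

∈∪⁺ʳ : ∀ {A B x} → x ∈ B → x ∈ A ∪ B
∈∪⁺ʳ {A} {B} {x} h =
  ∈-setOf⁺ {A + B} {λ y → testBit A y ∨ testBit B y} {x} (<-≤-trans (∈⇒< h) (m≤n+m B A)) (Equivalence.from T-∨ (inj₂ (unmem h)))

∈∪⁻ : ∀ {A B x} → x ∈ A ∪ B → x ∈ A ⊎ x ∈ B
∈∪⁻ {A} {B} {x} h with Equivalence.to T-∨ (proj₂ (∈-setOf⁻ {A + B} {λ y → testBit A y ∨ testBit B y} {x} h))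
... | inj₁ a = inj₁ (mem a)
... | inj₂ b = inj₂ (mem b)

∈⋃⁺ : ∀ {π B x} → B ∈ π → x ∈ B → x ∈ ⋃ π
∈⋃⁺ {π} {B} {x} B∈ x∈ =
  ∈-setOf⁺ {π} {λ y → any< π (λ C → testBit π C ∧ testBit C y)} {x}
    (<-≤-trans (∈⇒< x∈) (<⇒≤ (∈⇒< B∈)))
    (any<⁺ {π} {λ C → testBit π C ∧ testBit C x} {B} (∈⇒< B∈) (Equivalence.from T-∧ (unmem B∈ , unmem x∈)))

∈⋃⁻ : ∀ {π x} → x ∈ ⋃ π → Σ ℕ (λ B → B ∈ π × x ∈ B)
∈⋃⁻ {π} {x} h with any<⁻ {π} {λ C → testBit π C ∧ testBit C x} (proj₂ (∈-setOf⁻ {π} {λ y → any< π (λ C → testBit π C ∧ testBit C y)} {x} h))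
... | (B , _ , q) = B , mem (proj₁ (Equivalence.to T-∧ q)) , mem (proj₂ (Equivalence.to T-∧ q))

∈image⁺ : ∀ {X h D} → D ∈ X → h D ∈ image X h
∈image⁺ {X} {h} {D} D∈ =
  ∈-setOf⁺ {suc (max< X h)} {λ y → any< X (λ E → testBit X E ∧ (h E ≡ᵇ y))} {h D}
    (s≤s (max<-bound {X} {h} {D} (∈⇒< D∈)))
    (any<⁺ {X} {λ E → testBit X E ∧ (h E ≡ᵇ h D)} {D} (∈⇒< D∈) (Equivalence.from T-∧ (unmem D∈ , ≡⇒≡ᵇ (h D) (h D) refl)))

∈image⁻ : ∀ {X h y} → y ∈ image X h → Σ ℕ (λ D → D ∈ X × h D ≡ y)
∈image⁻ {X} {h} {y} q with any<⁻ {X} {λ E → testBit X E ∧ (h E ≡ᵇ y)} (proj₂ (∈-setOf⁻ {suc (max< X h)} {λ z → any< X (λ E → testBit X E ∧ (h E ≡ᵇ z))} {y} q))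
... | (D , _ , r) with Equivalence.to T-∧ r
...   | (D∈ , eq) = D , mem D∈ , ≡ᵇ⇒≡ (h D) y eq

nonEmpty⁺ : ∀ {B x} → x ∈ B → NonEmpty B
nonEmpty⁺ {B} {x} h = any<⁺ {B} {testBit B} {x} (∈⇒< h) (unmem h)

nonEmpty⁻ : ∀ {B} → NonEmpty B → Σ ℕ (λ x → x ∈ B)
nonEmpty⁻ {B} h with any<⁻ {B} {testBit B} h
... | (x , _ , q) = x , mem q

record Split (V V₁ V₂ : ℕ) : Set where
  field
    inl      : ∀ {x} → x ∈ V₁ → x ∈ V
    inr      : ∀ {x} → x ∈ V₂ → x ∈ V
    cover    : ∀ {x} → x ∈ V → x ∈ V₁ ⊎ x ∈ V₂
    disjoint : ∀ {x} → x ∈ V₁ → x ∈ V₂ → ⊥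

record IsPartitionOf (π V : ℕ) : Set where
  field
    nonempty : ∀ {B} → B ∈ π → NonEmpty B
    disjoint : ∀ {B B′ x} → B ∈ π → B′ ∈ π → x ∈ B → x ∈ B′ → B ≡ B′
    ⊆V       : ∀ {B x} → B ∈ π → x ∈ B → x ∈ V
    cover    : ∀ {x} → x ∈ V → Σ ℕ (λ B → B ∈ π × x ∈ B)

Asm : (ℕ → Set) → ℕ → Set
Asm P π = (B : ℕ) → B ∈ π → P B

record Bij (X Y : ℕ) : Set where
  field
    to      : ℕ → ℕ
    from    : ℕ → ℕ
    to∈     : ∀ {x} → x ∈ X → to x ∈ Y
    from∈   : ∀ {y} → y ∈ Y → from y ∈ X
    from-to : ∀ {x} → x ∈ X → from (to x) ≡ x
    to-from : ∀ {y} → y ∈ Y → to (from y) ≡ y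

idB : ∀ X → Bij X X
idB X = record { to = λ x → x ; from = λ x → x ; to∈ = λ h → h ; from∈ = λ h → h
               ; from-to = λ _ → refl ; to-from = λ _ → refl }

infixr 9 _∘B_
_∘B_ : ∀ {X Y Z} → Bij Y Z → Bij X Y → Bij X Z
g ∘B f = record
  { to = λ x → Bij.to g (Bij.to f x)
  ; from = λ z → Bij.from f (Bij.from g z)
  ; to∈ = λ h → Bij.to∈ g (Bij.to∈ f h)
  ; from∈ = λ h → Bij.from∈ f (Bij.from∈ g h)
  ; from-to = λ h → trans (cong (Bij.from f) (Bij.from-to g (Bij.to∈ f h))) (Bij.from-to f h)
  ; to-from = λ h → trans (cong (Bij.to g) (Bij.to-from f (Bij.from∈ g h))) (Bij.to-from g h)
  }

fromInj : ∀ X (h : ℕ → ℕ) →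
          (∀ {x x′} → x ∈ X → x′ ∈ X → h x ≡ h x′ → x ≡ x′) →
          Bij X (image X h)
fromInj X h inj = record
  { to = h
  ; from = inv
  ; to∈ = ∈image⁺ {X} {h}
  ; from∈ = λ q → proj₁ (spec q)
  ; from-to = λ {x} x∈ → fromto x x∈
  ; to-from = λ q → proj₂ (spec q)
  }
  where
  P : ℕ → ℕ → Bool
  P y D = testBit X D ∧ (h D ≡ᵇ y)
  inv : ℕ → ℕ
  inv y = search X (P y)
  spec′ : ∀ {y D} → D ∈ X → h D ≡ y → inv y ∈ X × h (inv y) ≡ y
  spec′ {y} {D} D∈ eq with Equivalence.to T-∧
      (search-sound {X} {P y} {D} (∈⇒< D∈) (Equivalence.from T-∧ (unmem D∈ , ≡⇒≡ᵇ (h D) y eq)))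
  ... | (a , b) = mem a , ≡ᵇ⇒≡ (h (inv y)) y b
  spec : ∀ {y} → y ∈ image X h → inv y ∈ X × h (inv y) ≡ y
  spec q with ∈image⁻ {X} {h} q
  ... | (D , D∈ , eq) = spec′ D∈ eq
  fromto : ∀ x → x ∈ X → inv (h x) ≡ x
  fromto x x∈ with spec′ {h x} {x} x∈ refl
  ... | (a , b) = inj a x∈ b

restrictB : ∀ {X Y S} (f : Bij X Y) → (∀ {x} → x ∈ S → x ∈ X) →
            Bij S (image S (Bij.to f))
restrictB {S = S} f sub = fromInj S (Bij.to f) (λ {x} {x′} x∈ x′∈ eq →
  trans (sym (Bij.from-to f (sub x∈)))
        (trans (cong (Bij.from f) eq) (Bij.from-to f (sub x′∈))))

-- 4. Species: functors from finite sets with bijections to sets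

record Species : Set₁ where
  field
    F        : ℕ → Set
    act      : ∀ {X Y} → Bij X Y → F X → F Y
    act-id   : ∀ {X} (u : F X) → act (idB X) u ≡ u
    act-∘    : ∀ {X Y Z} (g : Bij Y Z) (f : Bij X Y) (u : F X) →
               act (g ∘B f) u ≡ act g (act f u)
    -- a bijection is determined by its values on its domain
    act-cong : ∀ {X Y} (f g : Bij X Y) →
               (∀ {x} → x ∈ X → Bij.to f x ≡ Bij.to g x) →
               ∀ (u : F X) → act f u ≡ act g u

infix 20 _⟦_⟧
_⟦_⟧ : Species → ℕ → Set
S ⟦ V ⟧ = Species.F S V

private
  inj-to : ∀ {X Y} (f : Bij X Y) {x x′} → x ∈ X → x′ ∈ X →
           Bij.to f x ≡ Bij.to f x′ → x ≡ x′
  inj-to f x∈ x′∈ eq = trans (sym (Bij.from-to f x∈))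
                             (trans (cong (Bij.from f) eq) (Bij.from-to f x′∈))

imgB : ∀ {X Y} → Bij X Y → ℕ → ℕ
imgB f B = image B (Bij.to f)

splitImg : ∀ {X Y V₁ V₂} (f : Bij X Y) → Split X V₁ V₂ →
           Split Y (image V₁ (Bij.to f)) (image V₂ (Bij.to f))
splitImg {X} {Y} {V₁} {V₂} f s = record
  { inl = λ q → side (Split.inl s) q
  ; inr = λ q → side (Split.inr s) q
  ; cover = cov
  ; disjoint = dis
  }
  where
  to = Bij.to f
  side : ∀ {W} → (∀ {x} → x ∈ W → x ∈ X) → ∀ {y} → y ∈ image W to → y ∈ Y
  side i q with ∈image⁻ q
  ... | (x , x∈ , eq) = subst (λ z → z ∈ Y) eq (Bij.to∈ f (i x∈))
  cov : ∀ {y} → y ∈ Y → y ∈ image V₁ to ⊎ y ∈ image V₂ to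
  cov {y} y∈ with Split.cover s (Bij.from∈ f y∈)
  ... | inj₁ a = inj₁ (subst (λ z → z ∈ image V₁ to) (Bij.to-from f y∈) (∈image⁺ a))
  ... | inj₂ b = inj₂ (subst (λ z → z ∈ image V₂ to) (Bij.to-from f y∈) (∈image⁺ b))
  dis : ∀ {y} → y ∈ image V₁ to → y ∈ image V₂ to → ⊥
  dis q r with ∈image⁻ q | ∈image⁻ r
  ... | (x₁ , a₁ , e₁) | (x₂ , a₂ , e₂) =
    Split.disjoint s a₁
      (subst (λ z → z ∈ V₂)
             (sym (inj-to f (Split.inl s a₁) (Split.inr s a₂) (trans e₁ (sym e₂)))) a₂)

partImg : ∀ {X Y π V} (f : Bij X Y) → (∀ {x} → x ∈ V → x ∈ X) →
          IsPartitionOf π V →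
          IsPartitionOf (image π (imgB f)) (image V (Bij.to f))
partImg {X} {Y} {π} {V} f sub p = record
  { nonempty = ne ; disjoint = dj ; ⊆V = sv ; cover = cv }
  where
  open IsPartitionOf p
  to = Bij.to f
  ne : ∀ {B′} → B′ ∈ image π (imgB f) → NonEmpty B′
  ne q with ∈image⁻ q
  ... | (B , b , e) with nonEmpty⁻ (nonempty b)
  ...   | (x , x∈) = subst NonEmpty e (nonEmpty⁺ (∈image⁺ {B} {to} x∈))
  dj : ∀ {B₁′ B₂′ y} → B₁′ ∈ image π (imgB f) → B₂′ ∈ image π (imgB f) →
       y ∈ B₁′ → y ∈ B₂′ → B₁′ ≡ B₂′
  dj {y = y} q₁ q₂ y₁ y₂ with ∈image⁻ q₁ | ∈image⁻ q₂
  ... | (B₁ , b₁ , e₁) | (B₂ , b₂ , e₂)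
    with ∈image⁻ (subst (λ z → y ∈ z) (sym e₁) y₁) | ∈image⁻ (subst (λ z → y ∈ z) (sym e₂) y₂)
  ...   | (x₁ , x₁∈ , d₁) | (x₂ , x₂∈ , d₂) =
    trans (sym e₁) (trans (cong (imgB f) B₁≡B₂) e₂)
    where
    x₁≡x₂ : x₁ ≡ x₂
    x₁≡x₂ = inj-to f (sub (⊆V b₁ x₁∈)) (sub (⊆V b₂ x₂∈)) (trans d₁ (sym d₂))
    B₁≡B₂ : B₁ ≡ B₂
    B₁≡B₂ = disjoint b₁ b₂ x₁∈ (subst (λ z → z ∈ B₂) (sym x₁≡x₂) x₂∈)
  sv : ∀ {B′ y} → B′ ∈ image π (imgB f) → y ∈ B′ → y ∈ image V to
  sv {y = y} q y∈ with ∈image⁻ q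
  ... | (B , b , e) with ∈image⁻ (subst (λ z → y ∈ z) (sym e) y∈)
  ...   | (x , x∈ , d) = subst (λ z → z ∈ image V to) d (∈image⁺ (⊆V b x∈))
  cv : ∀ {y} → y ∈ image V to → Σ ℕ (λ B′ → B′ ∈ image π (imgB f) × y ∈ B′)
  cv q with ∈image⁻ q
  ... | (x , x∈ , d) with cover x∈
  ...   | (B , b , x∈B) =
    imgB f B , ∈image⁺ b , subst (λ z → z ∈ imgB f B) d (∈image⁺ x∈B)

asmImg : ∀ (P : Species) {X Y π V} (f : Bij X Y) → (∀ {x} → x ∈ V → x ∈ X) →
         IsPartitionOf π V → Asm (P ⟦_⟧) π → Asm (P ⟦_⟧) (image π (imgB f))
asmImg P f sub p a B′ q with ∈image⁻ q
... | (B , b , e) =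
  subst (Species.F P) e
    (Species.act P (restrictB f (λ x∈ → sub (IsPartitionOf.⊆V p b x∈))) (a B b))

hatB : ∀ {X Y π V} (f : Bij X Y) → (∀ {x} → x ∈ V → x ∈ X) →
       IsPartitionOf π V → Bij π (image π (imgB f))
hatB {π = π} f sub p = fromInj π (imgB f) inj
  where
  open IsPartitionOf p
  inj : ∀ {B B′} → B ∈ π → B′ ∈ π → imgB f B ≡ imgB f B′ → B ≡ B′
  inj {B} {B′} b b′ e with nonEmpty⁻ (nonempty b)
  ... | (x , x∈) with ∈image⁻ (subst (λ z → Bij.to f x ∈ z) e (∈image⁺ {B} {Bij.to f} x∈))
  ...   | (x′ , x′∈ , d) =
    disjoint b b′ x∈
      (subst (λ z → z ∈ B′) (inj-to f (sub (⊆V b′ x′∈)) (sub (⊆V b x∈)) d) x′∈)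

subPartition : ∀ {π V π₁} → IsPartitionOf π V → (∀ {B} → B ∈ π₁ → B ∈ π) →
               IsPartitionOf π₁ (⋃ π₁)
subPartition p sub = record
  { nonempty = λ b → IsPartitionOf.nonempty p (sub b)
  ; disjoint = λ b b′ → IsPartitionOf.disjoint p (sub b) (sub b′)
  ; ⊆V = ∈⋃⁺
  ; cover = ∈⋃⁻
  }

blockPart : ∀ {π V σ D} → IsPartitionOf π V → IsPartitionOf σ π → D ∈ σ →
            IsPartitionOf D (⋃ D)
blockPart pπ pσ d = subPartition pπ (λ c → IsPartitionOf.⊆V pσ d c)

etaBarPart : ∀ {π V σ} → IsPartitionOf π V → IsPartitionOf σ π →
             IsPartitionOf (image σ ⋃) V
etaBarPart {π} {V} {σ} pπ pσ = record
  { nonempty = ne ; disjoint = dj ; ⊆V = sv ; cover = cv }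
  where
  module Pπ = IsPartitionOf pπ
  module Pσ = IsPartitionOf pσ
  ne : ∀ {B′} → B′ ∈ image σ ⋃ → NonEmpty B′
  ne q with ∈image⁻ q
  ... | (D , d , e) with nonEmpty⁻ (Pσ.nonempty d)
  ...   | (C , c) with nonEmpty⁻ (Pπ.nonempty (Pσ.⊆V d c))
  ...     | (x , x∈) = subst NonEmpty e (nonEmpty⁺ (∈⋃⁺ c x∈))
  dj : ∀ {B₁ B₂ x} → B₁ ∈ image σ ⋃ → B₂ ∈ image σ ⋃ → x ∈ B₁ → x ∈ B₂ → B₁ ≡ B₂
  dj {x = x} q₁ q₂ x₁ x₂ with ∈image⁻ q₁ | ∈image⁻ q₂
  ... | (D₁ , d₁ , e₁) | (D₂ , d₂ , e₂)
    with ∈⋃⁻ (subst (λ z → x ∈ z) (sym e₁) x₁) | ∈⋃⁻ (subst (λ z → x ∈ z) (sym e₂) x₂)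
  ...   | (C₁ , c₁ , x∈C₁) | (C₂ , c₂ , x∈C₂) =
    trans (sym e₁) (trans (cong ⋃ D₁≡D₂) e₂)
    where
    C₁≡C₂ : C₁ ≡ C₂
    C₁≡C₂ = Pπ.disjoint (Pσ.⊆V d₁ c₁) (Pσ.⊆V d₂ c₂) x∈C₁ x∈C₂
    D₁≡D₂ : D₁ ≡ D₂
    D₁≡D₂ = Pσ.disjoint d₁ d₂ c₁ (subst (λ z → z ∈ D₂) (sym C₁≡C₂) c₂)
  sv : ∀ {B x} → B ∈ image σ ⋃ → x ∈ B → x ∈ V
  sv {x = x} q x∈ with ∈image⁻ q
  ... | (D , d , e) with ∈⋃⁻ (subst (λ z → x ∈ z) (sym e) x∈)
  ...   | (C , c , x∈C) = Pπ.⊆V (Pσ.⊆V d c) x∈C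
  cv : ∀ {x} → x ∈ V → Σ ℕ (λ B → B ∈ image σ ⋃ × x ∈ B)
  cv x∈ with Pπ.cover x∈
  ... | (C , c , x∈C) with Pσ.cover c
  ...   | (D , d , C∈D) = ⋃ D , ∈image⁺ d , ∈⋃⁺ C∈D x∈C

φ : ∀ {π V σ} → IsPartitionOf π V → IsPartitionOf σ π → Bij σ (image σ ⋃)
φ {π} {V} {σ} pπ pσ = fromInj σ ⋃ inj
  where
  module Pπ = IsPartitionOf pπ
  module Pσ = IsPartitionOf pσ
  inj : ∀ {D D′} → D ∈ σ → D′ ∈ σ → ⋃ D ≡ ⋃ D′ → D ≡ D′
  inj {D} {D′} d d′ e with nonEmpty⁻ (Pσ.nonempty d)
  ... | (C , c) with nonEmpty⁻ (Pπ.nonempty (Pσ.⊆V d c))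
  ...   | (x , x∈) with ∈⋃⁻ (subst (λ z → x ∈ z) e (∈⋃⁺ c x∈))
  ...     | (C′ , c′ , x∈C′) =
    Pσ.disjoint d d′ c
      (subst (λ z → z ∈ D′) (sym (Pπ.disjoint (Pσ.⊆V d c) (Pσ.⊆V d′ c′) x∈ x∈C′)) c′)

η̄ : ∀ {O : ℕ → Set} →
     (η : ∀ {π V} → IsPartitionOf π V → Asm O π → O π → O V) →
     ∀ {π V σ} (pπ : IsPartitionOf π V) (pσ : IsPartitionOf σ π) →
     Asm O π → Asm O σ → Asm O (image σ ⋃)
η̄ {O} η pπ pσ a b B′ q with ∈image⁻ q
... | (D , d , e) =
  subst O e (η (blockPart pπ pσ d) (λ C c → a C (IsPartitionOf.⊆V pσ d c)) (b D d))

singletons : ℕ → ℕ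
singletons V = image V ⟨_⟩

⟨⟩-inj : ∀ {v w} → ⟨ v ⟩ ≡ ⟨ w ⟩ → v ≡ w
⟨⟩-inj {v} {w} eq = ∈⟨⟩⁻ (subst (λ z → v ∈ z) eq (∈⟨⟩⁺ v))

singleB : ∀ V → Bij V (singletons V)
singleB V = fromInj V ⟨_⟩ (λ _ _ → ⟨⟩-inj)

eAsm : ∀ {O : ℕ → Set} → (∀ v → O ⟨ v ⟩) → ∀ V → Asm O (singletons V)
eAsm {O} e V B q with ∈image⁻ {V} {⟨_⟩} q
... | (v , _ , eq) = subst O eq (e v)

oneBlock : ∀ {O : ℕ → Set} {V} → O V → Asm O ⟨ V ⟩
oneBlock {O} ω B q = subst O (sym (∈⟨⟩⁻ q)) ω

joinAsm : ∀ {O : ℕ → Set} {π π₁ π₂} → Split π π₁ π₂ →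
          Asm O π₁ → Asm O π₂ → Asm O π
joinAsm s a₁ a₂ B q with Split.cover s q
... | inj₁ b = a₁ B b
... | inj₂ b = a₂ B b

restrictAsm : ∀ {O : ℕ → Set} {π π₁} → (∀ {B} → B ∈ π₁ → B ∈ π) →
              Asm O π → Asm O π₁
restrictAsm sub a B q = a B (sub q)

splitUnion : ∀ {A B : ℕ} → (∀ {x} → x ∈ A → x ∈ B → ⊥) → Split (A ∪ B) A B
splitUnion {A} {B} d = record { inl = ∈∪⁺ˡ {A} {B} ; inr = ∈∪⁺ʳ {A} {B} ; cover = ∈∪⁻ {A} {B} ; disjoint = d }

retarget : ∀ {π A B} → (∀ {x} → x ∈ A → x ∈ B) → (∀ {x} → x ∈ B → x ∈ A) →
           IsPartitionOf π A → IsPartitionOf π B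
retarget ab ba p = record
  { nonempty = IsPartitionOf.nonempty p
  ; disjoint = IsPartitionOf.disjoint p
  ; ⊆V = λ b x∈ → ab (IsPartitionOf.⊆V p b x∈)
  ; cover = λ x∈ → IsPartitionOf.cover p (ba x∈)
  }

partImgY : ∀ {X Y π} (f : Bij X Y) → IsPartitionOf π X →
           IsPartitionOf (image π (imgB f)) Y
partImgY {X} {Y} f p = retarget ab ba (partImg f (λ h → h) p)
  where
  ab : ∀ {y} → y ∈ image X (Bij.to f) → y ∈ Y
  ab q with ∈image⁻ q
  ... | (x , x∈ , e) = subst (λ z → z ∈ Y) e (Bij.to∈ f x∈)
  ba : ∀ {y} → y ∈ Y → y ∈ image X (Bij.to f)
  ba y∈ = subst (λ z → z ∈ image X (Bij.to f)) (Bij.to-from f y∈)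
                (∈image⁺ {X} {Bij.to f} (Bij.from∈ f y∈))

-- an element (m, a) ∈ M[V₁] × E(O)[V₂] ⊆ (M · E(O))[V],  V = V₁ + V₂
record MEO (M O : Species) (V : ℕ) : Set where
  field
    V₁     : ℕ
    V₂     : ℕ
    split  : Split V V₁ V₂
    m      : M ⟦ V₁ ⟧
    part   : ℕ
    isPart : IsPartitionOf part V₂
    asm    : Asm (O ⟦_⟧) part

actMEO : ∀ {M O X Y} → Bij X Y → MEO M O X → MEO M O Y
actMEO {M} {O} f z = record
  { V₁ = image V₁ (Bij.to f)
  ; V₂ = image V₂ (Bij.to f)
  ; split = splitImg f split
  ; m = Species.act M (restrictB f (Split.inl split)) m
  ; part = image part (imgB f)
  ; isPart = partImg f (Split.inr split) isPart
  ; asm = asmImg O f (Split.inr split) isPart asm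
  }
  where open MEO z

record CMonop : Set₁ where
  field
    M O : Species
    𝔢       : M ⟦ ∅ ⟧
    ν       : ∀ {V V₁ V₂} → Split V V₁ V₂ → M ⟦ V₁ ⟧ → M ⟦ V₂ ⟧ → M ⟦ V ⟧
    ν-assoc : ∀ {V V₁ V₂ V₃ V₁₂ V₂₃}
                (s : Split V V₁₂ V₃) (s₁₂ : Split V₁₂ V₁ V₂)
                (s′ : Split V V₁ V₂₃) (s₂₃ : Split V₂₃ V₂ V₃)
                (m₁ : M ⟦ V₁ ⟧) (m₂ : M ⟦ V₂ ⟧) (m₃ : M ⟦ V₃ ⟧) →
              ν s (ν s₁₂ m₁ m₂) m₃ ≡ ν s′ m₁ (ν s₂₃ m₂ m₃)
    ν-unitˡ : ∀ {V} (s : Split V ∅ V) (m : M ⟦ V ⟧) → ν s 𝔢 m ≡ m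
    ν-unitʳ : ∀ {V} (s : Split V V ∅) (m : M ⟦ V ⟧) → ν s m 𝔢 ≡ m
    ν-nat   : ∀ {V W V₁ V₂} (g : Bij V W) (s : Split V V₁ V₂)
                (m₁ : M ⟦ V₁ ⟧) (m₂ : M ⟦ V₂ ⟧) →
              Species.act M g (ν s m₁ m₂)
                ≡ ν (splitImg g s) (Species.act M (restrictB g (Split.inl s)) m₁)
                                   (Species.act M (restrictB g (Split.inr s)) m₂)
    O-positive : O ⟦ ∅ ⟧ → ⊥
    e       : ∀ v → O ⟦ ⟨ v ⟩ ⟧
    η       : ∀ {π V} → IsPartitionOf π V → Asm (O ⟦_⟧) π → O ⟦ π ⟧ → O ⟦ V ⟧
    η-assoc : ∀ {π V σ} (pπ : IsPartitionOf π V) (pσ : IsPartitionOf σ π)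
                (a : Asm (O ⟦_⟧) π) (b : Asm (O ⟦_⟧) σ) (ω : O ⟦ σ ⟧) →
              η (etaBarPart pπ pσ) (η̄ η pπ pσ a b) (Species.act O (φ pπ pσ) ω)
                ≡ η pπ a (η pσ b ω)
    η-unitˡ : ∀ {V} (p : IsPartitionOf (singletons V) V) (ω : O ⟦ V ⟧) →
              η p (eAsm e V) (Species.act O (singleB V) ω) ≡ ω
    η-unitʳ : ∀ {V} (p : IsPartitionOf ⟨ V ⟩ V) (ω : O ⟦ V ⟧) →
              η p (oneBlock ω) (e V) ≡ ω
    η-nat   : ∀ {V W π} (g : Bij V W) (p : IsPartitionOf π V)
                (a : Asm (O ⟦_⟧) π) (ω : O ⟦ π ⟧) →
              Species.act O g (η p a ω)
                ≡ η (partImgY g p) (asmImg O g (λ h → h) p a)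
                    (Species.act O (hatB g (λ h → h) p) ω)
    τ       : ∀ {π V} → IsPartitionOf π V → Asm (O ⟦_⟧) π → M ⟦ π ⟧ → M ⟦ V ⟧
    τ-assoc : ∀ {π V σ} (pπ : IsPartitionOf π V) (pσ : IsPartitionOf σ π)
                (a : Asm (O ⟦_⟧) π) (b : Asm (O ⟦_⟧) σ) (m : M ⟦ σ ⟧) →
              τ (etaBarPart pπ pσ) (η̄ η pπ pσ a b) (Species.act M (φ pπ pσ) m)
                ≡ τ pπ a (τ pσ b m)
    τ-unit  : ∀ {V} (p : IsPartitionOf (singletons V) V) (m : M ⟦ V ⟧) →
              τ p (eAsm e V) (Species.act M (singleB V) m) ≡ m
    τ-nat   : ∀ {V W π} (g : Bij V W) (p : IsPartitionOf π V)
                (a : Asm (O ⟦_⟧) π) (m : M ⟦ π ⟧) →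
              Species.act M g (τ p a m)
                ≡ τ (partImgY g p) (asmImg O g (λ h → h) p a)
                    (Species.act M (hatB g (λ h → h) p) m)
    compat  : ∀ {V V₁ V₂ π π₁ π₂} (s : Split V V₁ V₂) (sπ : Split π π₁ π₂)
                (p₁ : IsPartitionOf π₁ V₁) (p₂ : IsPartitionOf π₂ V₂)
                (p : IsPartitionOf π V)
                (a₁ : Asm (O ⟦_⟧) π₁) (a₂ : Asm (O ⟦_⟧) π₂)
                (m₁ : M ⟦ π₁ ⟧) (m₂ : M ⟦ π₂ ⟧) →
              ν s (τ p₁ a₁ m₁) (τ p₂ a₂ m₂) ≡ τ p (joinAsm sπ a₁ a₂) (ν sπ m₁ m₂)
    M∅-single   : ∀ (m : M ⟦ ∅ ⟧) → m ≡ 𝔢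
    ν-cancel    : ∀ {V V₁ V₂} (s : Split V V₁ V₂)
                    (m₁ : M ⟦ V₁ ⟧) (m₂ m₂′ : M ⟦ V₂ ⟧) →
                  ν s m₁ m₂ ≡ ν s m₁ m₂′ → m₂ ≡ m₂′
    O-singleton : ∀ v (o : O ⟦ ⟨ v ⟩ ⟧) → o ≡ e v
    η-cancel    : ∀ {π V} (p : IsPartitionOf π V) (a : Asm (O ⟦_⟧) π)
                    (ω ω′ : O ⟦ π ⟧) → η p a ω ≡ η p a ω′ → ω ≡ ω′
    τ-cancel    : ∀ {π V} (p : IsPartitionOf π V) (a : Asm (O ⟦_⟧) π)
                    (m m′ : M ⟦ π ⟧) → τ p a m ≡ τ p a m′ → m ≡ m′

splitρ : ∀ {V V₁ V₂ π π₁ π₂} → Split V V₁ V₂ → IsPartitionOf π V₂ →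
         Split π π₁ π₂ → Split V (V₁ ∪ ⋃ π₁) (⋃ π₂)
splitρ {V} {V₁} {V₂} {π} {π₁} {π₂} s p s′ = record
  { inl = il ; inr = ir ; cover = cv ; disjoint = dj }
  where
  module S = Split s
  module S′ = Split s′
  module P = IsPartitionOf p
  il : ∀ {x} → x ∈ V₁ ∪ ⋃ π₁ → x ∈ V
  il q with ∈∪⁻ {V₁} {⋃ π₁} q
  ... | inj₁ a = S.inl a
  ... | inj₂ b with ∈⋃⁻ b
  ...   | (C , c , x∈C) = S.inr (P.⊆V (S′.inl c) x∈C)
  ir : ∀ {x} → x ∈ ⋃ π₂ → x ∈ V
  ir q with ∈⋃⁻ q
  ... | (C , c , x∈C) = S.inr (P.⊆V (S′.inr c) x∈C)
  cv : ∀ {x} → x ∈ V → x ∈ V₁ ∪ ⋃ π₁ ⊎ x ∈ ⋃ π₂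
  cv x∈ with S.cover x∈
  ... | inj₁ a = inj₁ (∈∪⁺ˡ {V₁} {⋃ π₁} a)
  ... | inj₂ b with P.cover b
  ...   | (C , c , x∈C) with S′.cover c
  ...     | inj₁ c₁ = inj₁ (∈∪⁺ʳ {V₁} {⋃ π₁} (∈⋃⁺ c₁ x∈C))
  ...     | inj₂ c₂ = inj₂ (∈⋃⁺ c₂ x∈C)
  dj : ∀ {x} → x ∈ V₁ ∪ ⋃ π₁ → x ∈ ⋃ π₂ → ⊥
  dj q r with ∈⋃⁻ r
  ... | (C₂ , c₂ , x∈C₂) with ∈∪⁻ {V₁} {⋃ π₁} q
  ...   | inj₁ a = S.disjoint a (P.⊆V (S′.inr c₂) x∈C₂)
  ...   | inj₂ b with ∈⋃⁻ b
  ...     | (C₁ , c₁ , x∈C₁) =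
    S′.disjoint c₁
      (subst (λ z → z ∈ π₂)
             (sym (P.disjoint (S′.inl c₁) (S′.inr c₂) x∈C₁ x∈C₂)) c₂)

disjρ : ∀ {V V₁ V₂ π π₁ π₂} → Split V V₁ V₂ → IsPartitionOf π V₂ →
        Split π π₁ π₂ → ∀ {x} → x ∈ V₁ → x ∈ ⋃ π₁ → ⊥
disjρ s p s′ a b with ∈⋃⁻ b
... | (C , c , x∈C) =
  Split.disjoint s a (IsPartitionOf.⊆V p (Split.inl s′ c) x∈C)

module _ (C : CMonop) where
  open CMonop C

  -- ρ̄((m₁,a₁),(m₂′,a₂′)) = (ν(m₁, τ(a₁⁽¹⁾, m₂′)), η̄(a₁⁽²⁾, a₂′))
  ρ̄ : ∀ {V} (x : MEO M O V) → MEO M O (MEO.part x) → MEO M O V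
  ρ̄ x y = record
    { V₁ = X.V₁ ∪ ⋃ Y.V₁
    ; V₂ = ⋃ Y.V₂
    ; split = splitρ X.split X.isPart Y.split
    ; m = ν (splitUnion (disjρ X.split X.isPart Y.split))
            X.m
            (τ (subPartition X.isPart (Split.inl Y.split))
               (restrictAsm (Split.inl Y.split) X.asm) Y.m)
    ; part = image Y.part ⋃
    ; isPart = etaBarPart (subPartition X.isPart (Split.inr Y.split)) Y.isPart
    ; asm = η̄ η (subPartition X.isPart (Split.inr Y.split)) Y.isPart
              (restrictAsm (Split.inr Y.split) X.asm) Y.asm
    }
    where
    module X = MEO x
    module Y = MEO y

  ident : ∀ {V} (x : MEO M O V) (y : MEO M O (MEO.part x)) →
          Bij (MEO.part y) (MEO.part (ρ̄ x y))
  ident x y = φ (subPartition (MEO.isPart x) (Split.inr (MEO.split y))) (MEO.isPart y)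

  Mpart : ∀ {V} → MEO M O V → Σ ℕ (λ W → M ⟦ W ⟧)
  Mpart x = MEO.V₁ x , MEO.m x

  Epart : ∀ {V} → MEO M O V → Σ ℕ (λ π → Asm (O ⟦_⟧) π)
  Epart x = MEO.part x , MEO.asm x

  unitM : Σ ℕ (λ W → M ⟦ W ⟧)
  unitM = ∅ , 𝔢

  idAsm : ℕ → Σ ℕ (λ π → Asm (O ⟦_⟧) π)
  idAsm W = singletons W , eAsm e W

  -- equality of elements (m, a) of (M · E(O))[V]
  -- (the remaining fields are proofs, or determined by these)
  infix 4 _≈_
  _≈_ : ∀ {V} → MEO M O V → MEO M O V → Set
  x ≈ y = Mpart x ≡ Mpart y × Epart x ≡ Epart y

-- Sets are coded by natural numbers, so two sets with the same members are equal, and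
-- under function extensionality all proof components (memberships, splittings,
-- partitions) are irrelevant; structures are therefore compared packed with their supports.
--
-- Associativity: on the M-component, ν-associativity reduces it to the middle factor, where
-- τ-associativity rewrites the action of the η̄-assembly of ρ̄ x y on m₃ as a₁ acting after a₂,
-- and the compatibility of ν and τ merges the two actions of a₁. On the E-component both sides
-- have the blocks ⋃ ⋃ D, D a block of a₃, and agree there by η-associativity.
-- Left cancellation recovers the partitions from their unions (blocks are nonempty and disjoint)
-- and then peels off ν, τ and η with the cancellation axioms. For the unit: the M-support of
-- ρ̄ x y is empty, so both M-components live on ∅; every block ⋃ D is a singleton, so all blocks
-- of a₁ and a₂ are singletons, on which O has only the identity.

module Submission where

open import Defs
open import Level using (0ℓ)
open import Data.Nat.Base using (ℕ; zero; suc; _+_; _≤_; z≤n; ⌊_/2⌋)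
open import Data.Nat.Properties using (≤-trans; ≤-pred; m≤m+n; m≤n+m; ⌊n/2⌋-mono; ⌊n/2⌋<n)
open import Data.Bool.Base using (Bool; true; false; T; if_then_else_)
open import Data.Bool.Properties using (T-irrelevant)
open import Data.Unit.Base using (tt)
open import Data.Product.Base using (Σ; _×_; _,_; proj₁; proj₂)
open import Data.Sum.Base using (inj₁; inj₂)
open import Data.Empty using (⊥; ⊥-elim)
open import Function.Base using (id)
open import Relation.Binary.PropositionalEquality
  using (_≡_; refl; sym; trans; cong; cong₂; subst)
open import Axiom.UniquenessOfIdentityProofs.WithK using (uip)
open import Axiom.Extensionality.Propositional
  using (Extensionality; implicit-extensionality)

infix 4 _⊆_
_⊆_ : ℕ → ℕ → Set
A ⊆ B = ∀ {x} → x ∈ A → x ∈ B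

∈-irrelevant : ∀ {x A} (p q : x ∈ A) → p ≡ q
∈-irrelevant (mem p) (mem q) = cong mem (T-irrelevant p q)

private
  odd-double-⌊/2⌋ : ∀ A → A ≡ (if odd A then suc else id) (double ⌊ A /2⌋)
  odd-double-⌊/2⌋ zero = refl
  odd-double-⌊/2⌋ (suc zero) = refl
  odd-double-⌊/2⌋ (suc (suc A)) with odd A | odd-double-⌊/2⌋ A
  ... | true  | r = cong (λ n → suc (suc n)) r
  ... | false | r = cong (λ n → suc (suc n)) r

  -- n is fuel bounding both codes; halving a nonzero code strictly decreases it
  testBit-injective : ∀ n {A B} → A ≤ n → B ≤ n →
                      (∀ x → testBit A x ≡ testBit B x) → A ≡ B
  testBit-injective zero z≤n z≤n _ = refl
  testBit-injective (suc n) {A} {B} A≤ B≤ same =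
    trans (odd-double-⌊/2⌋ A)
      (trans (cong₂ (λ b k → (if b then suc else id) (double k)) (same 0)
               (testBit-injective n (halve A≤) (halve B≤) (λ x → same (suc x))))
             (sym (odd-double-⌊/2⌋ B)))
    where
    halve : ∀ {C} → C ≤ suc n → ⌊ C /2⌋ ≤ n
    halve C≤ = ≤-trans (⌊n/2⌋-mono C≤) (≤-pred (⌊n/2⌋<n n))

  T-ext : ∀ {a b : Bool} → (T a → T b) → (T b → T a) → a ≡ b
  T-ext {true}  {true}  _ _ = refl
  T-ext {true}  {false} f _ = ⊥-elim (f tt)
  T-ext {false} {true}  _ g = ⊥-elim (g tt)
  T-ext {false} {false} _ _ = refl

⊆-antisym : ∀ {A B} → A ⊆ B → B ⊆ A → A ≡ B
⊆-antisym {A} {B} A⊆B B⊆A =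
  testBit-injective (A + B) (m≤m+n A B) (m≤n+m B A) λ x →
    T-ext (λ t → unmem (A⊆B {x} (mem t))) (λ t → unmem (B⊆A {x} (mem t)))

Disjoint : ℕ → ℕ → Set
Disjoint A B = ∀ {x} → x ∈ A → x ∈ B → ⊥

⋃-∪ : ∀ A B → ⋃ (A ∪ B) ≡ ⋃ A ∪ ⋃ B
⋃-∪ A B = ⊆-antisym to from
  where
  to : ⋃ (A ∪ B) ⊆ ⋃ A ∪ ⋃ B
  to q with ∈⋃⁻ q
  ... | C , c , x∈C with ∈∪⁻ {A} {B} c
  ...   | inj₁ a = ∈∪⁺ˡ {⋃ A} {⋃ B} (∈⋃⁺ a x∈C)
  ...   | inj₂ b = ∈∪⁺ʳ {⋃ A} {⋃ B} (∈⋃⁺ b x∈C)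
  from : ⋃ A ∪ ⋃ B ⊆ ⋃ (A ∪ B)
  from q with ∈∪⁻ {⋃ A} {⋃ B} q
  ... | inj₁ a = let C , c , x∈C = ∈⋃⁻ a in ∈⋃⁺ (∈∪⁺ˡ {A} {B} c) x∈C
  ... | inj₂ b = let C , c , x∈C = ∈⋃⁻ b in ∈⋃⁺ (∈∪⁺ʳ {A} {B} c) x∈C

⋃-image-⋃ : ∀ S → ⋃ (image S ⋃) ≡ ⋃ (⋃ S)
⋃-image-⋃ S = ⊆-antisym to from
  where
  to : ⋃ (image S ⋃) ⊆ ⋃ (⋃ S)
  to q with ∈⋃⁻ q
  ... | B , b , x∈B with ∈image⁻ {S} {⋃} b
  ...   | D , d , refl = let C , c , x∈C = ∈⋃⁻ x∈B in ∈⋃⁺ (∈⋃⁺ d c) x∈C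
  from : ⋃ (⋃ S) ⊆ ⋃ (image S ⋃)
  from q with ∈⋃⁻ q
  ... | C , c , x∈C = let D , d , c∈D = ∈⋃⁻ c in ∈⋃⁺ (∈image⁺ {S} {⋃} d) (∈⋃⁺ c∈D x∈C)

image-∘ : ∀ S f g → image (image S f) g ≡ image S (λ D → g (f D))
image-∘ S f g = ⊆-antisym to from
  where
  to : image (image S f) g ⊆ image S (λ D → g (f D))
  to q with ∈image⁻ {image S f} {g} q
  ... | E , e , refl with ∈image⁻ {S} {f} e
  ...   | D , d , refl = ∈image⁺ {S} {λ D → g (f D)} d
  from : image S (λ D → g (f D)) ⊆ image (image S f) g
  from q with ∈image⁻ {S} {λ D → g (f D)} q
  ... | D , d , refl = ∈image⁺ {image S f} {g} (∈image⁺ {S} {f} d)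

image-cong : ∀ S f g → (∀ {D} → D ∈ S → f D ≡ g D) → image S f ≡ image S g
image-cong S f g f≗g = ⊆-antisym (to f g f≗g) (to g f (λ d → sym (f≗g d)))
  where
  to : ∀ f g → (∀ {D} → D ∈ S → f D ≡ g D) → image S f ⊆ image S g
  to f g f≗g q with ∈image⁻ {S} {f} q
  ... | D , d , refl = subst (_∈ image S g) (sym (f≗g d)) (∈image⁺ {S} {g} d)

∪-cancelˡ : ∀ {A B B′} → Disjoint A B → Disjoint A B′ → A ∪ B ≡ A ∪ B′ → B ≡ B′
∪-cancelˡ {A} A#B A#B′ eq = ⊆-antisym (to A#B eq) (to A#B′ (sym eq))
  where
  to : ∀ {B B′} → Disjoint A B → A ∪ B ≡ A ∪ B′ → B ⊆ B′
  to {B} {B′} A#B eq b with ∈∪⁻ {A} {B′} (subst (_ ∈_) eq (∈∪⁺ʳ {A} {B} b))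
  ... | inj₁ a  = ⊥-elim (A#B a b)
  ... | inj₂ b′ = b′

-- blocks are nonempty and disjoint, so a set of blocks is recovered from its union
⋃-injective : ∀ {π W D D′} → IsPartitionOf π W → D ⊆ π → D′ ⊆ π → ⋃ D ≡ ⋃ D′ → D ≡ D′
⋃-injective {π} p D⊆π D′⊆π eq = ⊆-antisym (to D⊆π D′⊆π eq) (to D′⊆π D⊆π (sym eq))
  where
  open IsPartitionOf p
  to : ∀ {D D′} → D ⊆ π → D′ ⊆ π → ⋃ D ≡ ⋃ D′ → D ⊆ D′
  to {D′ = D′} D⊆π D′⊆π eq {C} c with nonEmpty⁻ (nonempty (D⊆π c))
  ... | x , x∈C with ∈⋃⁻ (subst (x ∈_) eq (∈⋃⁺ c x∈C))
  ...   | C′ , c′ , x∈C′ = subst (_∈ D′) (disjoint (D′⊆π c′) (D⊆π c) x∈C′ x∈C) c′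

∉⇒≡∅ : ∀ {A} → (∀ {x} → x ∈ A → ⊥) → A ≡ ∅
∉⇒≡∅ A-empty = ⊆-antisym (λ q → ⊥-elim (A-empty q)) (λ q → ⊥-elim (∉∅ q))

≡∅⇒∉ : ∀ {A x} → A ≡ ∅ → x ∈ A → ⊥
≡∅⇒∉ refl = ∉∅

∪-≡∅ : ∀ {A B} → A ∪ B ≡ ∅ → A ≡ ∅ × B ≡ ∅
∪-≡∅ {A} {B} eq = ∉⇒≡∅ (λ a → ≡∅⇒∉ eq (∈∪⁺ˡ {A} {B} a))
                , ∉⇒≡∅ (λ b → ≡∅⇒∉ eq (∈∪⁺ʳ {A} {B} b))

⋃-≡∅ : ∀ {S π W} → IsPartitionOf π W → S ⊆ π → ⋃ S ≡ ∅ → S ≡ ∅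
⋃-≡∅ p S⊆π eq = ∉⇒≡∅ λ c →
  let x , x∈C = nonEmpty⁻ (IsPartitionOf.nonempty p (S⊆π c)) in ≡∅⇒∉ eq (∈⋃⁺ c x∈C)

⊆⟨⟩⇒≡⟨⟩ : ∀ {B u} → NonEmpty B → (∀ {x} → x ∈ B → x ≡ u) → B ≡ ⟨ u ⟩
⊆⟨⟩⇒≡⟨⟩ {B} {u} ne B⊆u with nonEmpty⁻ ne
... | y , y∈B = ⊆-antisym (λ q → subst (_∈ ⟨ u ⟩) (sym (B⊆u q)) (∈⟨⟩⁺ u))
                          (λ q → subst (_∈ B) (trans (B⊆u y∈B) (sym (∈⟨⟩⁻ q))) y∈B)

singleton-blocks⇒≡singletons : ∀ {π W} → IsPartitionOf π W →
                               (∀ {B} → B ∈ π → Σ ℕ (λ v → B ≡ ⟨ v ⟩)) → π ≡ singletons W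
singleton-blocks⇒≡singletons {π} {W} p singleton = ⊆-antisym to from
  where
  to : π ⊆ singletons W
  to b with singleton b
  ... | v , refl = ∈image⁺ {W} {⟨_⟩} (IsPartitionOf.⊆V p b (∈⟨⟩⁺ v))
  from : singletons W ⊆ π
  from q with ∈image⁻ {W} {⟨_⟩} q
  ... | w , w∈W , refl with IsPartitionOf.cover p w∈W
  ...   | B , b , w∈B with singleton b
  ...     | v , refl = subst (λ u → ⟨ u ⟩ ∈ π) (sym (∈⟨⟩⁻ {v} w∈B)) b

module _ {V V₁₂ V₃ V₁ V₂} (s : Split V V₁₂ V₃) (s₁₂ : Split V₁₂ V₁ V₂) where

  Split-disjoint₂₃ : Disjoint V₂ V₃
  Split-disjoint₂₃ b = Split.disjoint s (Split.inr s₁₂ b)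

  Split-disjoint₁,₂₃ : Disjoint V₁ (V₂ ∪ V₃)
  Split-disjoint₁,₂₃ a q with ∈∪⁻ {V₂} {V₃} q
  ... | inj₁ b = Split.disjoint s₁₂ a b
  ... | inj₂ c = Split.disjoint s (Split.inl s₁₂ a) c

  Split-≡∪∪ : V ≡ V₁ ∪ (V₂ ∪ V₃)
  Split-≡∪∪ = ⊆-antisym to from
    where
    to : V ⊆ V₁ ∪ (V₂ ∪ V₃)
    to q with Split.cover s q
    ... | inj₂ c = ∈∪⁺ʳ {V₁} {V₂ ∪ V₃} (∈∪⁺ʳ {V₂} {V₃} c)
    ... | inj₁ ab with Split.cover s₁₂ ab
    ...   | inj₁ a = ∈∪⁺ˡ {V₁} {V₂ ∪ V₃} a
    ...   | inj₂ b = ∈∪⁺ʳ {V₁} {V₂ ∪ V₃} (∈∪⁺ˡ {V₂} {V₃} b)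
    from : V₁ ∪ (V₂ ∪ V₃) ⊆ V
    from q with ∈∪⁻ {V₁} {V₂ ∪ V₃} q
    ... | inj₁ a = Split.inl s (Split.inl s₁₂ a)
    ... | inj₂ bc with ∈∪⁻ {V₂} {V₃} bc
    ...   | inj₁ b = Split.inl s (Split.inr s₁₂ b)
    ...   | inj₂ c = Split.inr s c

⋃-⊆ : ∀ {σ W S} → IsPartitionOf σ W → S ⊆ σ → ⋃ S ⊆ W
⋃-⊆ p S⊆σ q = let C , c , x∈C = ∈⋃⁻ q in IsPartitionOf.⊆V p (S⊆σ c) x∈C

⋃-Disjoint : ∀ {π W π₁ π₂} → IsPartitionOf π W → π₁ ⊆ π → π₂ ⊆ π →
             Disjoint π₁ π₂ → Disjoint (⋃ π₁) (⋃ π₂)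
⋃-Disjoint p π₁⊆π π₂⊆π π₁#π₂ q r with ∈⋃⁻ q | ∈⋃⁻ r
... | C₁ , c₁ , x∈C₁ | C₂ , c₂ , x∈C₂ =
  π₁#π₂ c₁ (subst (_∈ _) (IsPartitionOf.disjoint p (π₂⊆π c₂) (π₁⊆π c₁) x∈C₂ x∈C₁) c₂)

image-⋃-injective : ∀ {π W σ σ′} → IsPartitionOf π W →
                    (∀ {D} → D ∈ σ → D ⊆ π) → (∀ {D} → D ∈ σ′ → D ⊆ π) →
                    image σ ⋃ ≡ image σ′ ⋃ → σ ≡ σ′
image-⋃-injective {π} p σ⊆ σ′⊆ eq = ⊆-antisym (to σ⊆ σ′⊆ eq) (to σ′⊆ σ⊆ (sym eq))
  where
  to : ∀ {σ σ′} → (∀ {D} → D ∈ σ → D ⊆ π) → (∀ {D} → D ∈ σ′ → D ⊆ π) →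
       image σ ⋃ ≡ image σ′ ⋃ → σ ⊆ σ′
  to {σ} {σ′} σ⊆ σ′⊆ eq {D} d with ∈image⁻ {σ′} {⋃} (subst (⋃ D ∈_) eq (∈image⁺ {σ} {⋃} d))
  ... | D′ , d′ , ⋃D′≡⋃D = subst (_∈ σ′) (⋃-injective p (σ′⊆ d′) (σ⊆ d) ⋃D′≡⋃D) d′

Asm-≡⁻ : ∀ {P : ℕ → Set} {π π′} {a : Asm P π} {a′ : Asm P π′} →
         _≡_ {A = Σ ℕ (Asm P)} (π , a) (π′ , a′) →
         ∀ B (b : B ∈ π) (b′ : B ∈ π′) → a B b ≡ a′ B b′
Asm-≡⁻ {a = a} refl B b b′ = cong (a B) (∈-irrelevant b b′)

module _ (ext : Extensionality 0ℓ 0ℓ) where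

  private
    iext : ∀ {A : Set} {B : A → Set} {f g : ∀ {x} → B x} →
           (∀ x → f {x} ≡ g {x}) → (λ {x} → f {x}) ≡ (λ {x} → g {x})
    iext f≗g = implicit-extensionality ext (λ {x} → f≗g x)

  Asm-≡ : ∀ {P : ℕ → Set} {π π′} {a : Asm P π} {a′ : Asm P π′} → π ≡ π′ →
          (∀ B (b : B ∈ π) (b′ : B ∈ π′) → a B b ≡ a′ B b′) →
          _≡_ {A = Σ ℕ (Asm P)} (π , a) (π′ , a′)
  Asm-≡ refl a≗a′ = cong (_ ,_) (ext λ B → ext λ b → a≗a′ B b b)

  Split-irrelevant : ∀ {V V₁ V₂} (s s′ : Split V V₁ V₂) → s ≡ s′
  Split-irrelevant s s′ =
    fields-≡ (iext λ _ → ext λ _ → ∈-irrelevant _ _)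
             (iext λ _ → ext λ _ → ∈-irrelevant _ _)
             (iext λ _ → ext cover-≡)
             (iext λ _ → ext λ p → ext λ q → ⊥-elim (Split.disjoint s p q))
    where
    module S = Split s
    module S′ = Split s′
    cover-≡ : ∀ {x} (p : x ∈ _) → S.cover p ≡ S′.cover p
    cover-≡ p with S.cover p | S′.cover p
    ... | inj₁ a | inj₁ b = cong inj₁ (∈-irrelevant a b)
    ... | inj₂ a | inj₂ b = cong inj₂ (∈-irrelevant a b)
    ... | inj₁ a | inj₂ b = ⊥-elim (S.disjoint a b)
    ... | inj₂ a | inj₁ b = ⊥-elim (S.disjoint b a)
    fields-≡ : (λ {x} → S.inl {x}) ≡ S′.inl → (λ {x} → S.inr {x}) ≡ S′.inr →
               (λ {x} → S.cover {x}) ≡ S′.cover →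
               (λ {x} → S.disjoint {x}) ≡ S′.disjoint → s ≡ s′
    fields-≡ refl refl refl refl = refl

  IsPartitionOf-irrelevant : ∀ {π V} (p p′ : IsPartitionOf π V) → p ≡ p′
  IsPartitionOf-irrelevant p p′ =
    fields-≡ (iext λ _ → ext λ _ → T-irrelevant _ _)
             (iext λ _ → iext λ _ → iext λ _ →
                ext λ _ → ext λ _ → ext λ _ → ext λ _ → uip _ _)
             (iext λ _ → iext λ _ → ext λ _ → ext λ _ → ∈-irrelevant _ _)
             (iext λ _ → ext cover-≡)
    where
    module P = IsPartitionOf p
    module P′ = IsPartitionOf p′
    cover-≡ : ∀ {x} (u : x ∈ _) → P.cover u ≡ P′.cover u
    cover-≡ u with P.cover u | P′.cover u
    ... | B , b , x∈B | B′ , b′ , x∈B′ with P.disjoint b b′ x∈B x∈B′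
    ...   | refl with ∈-irrelevant b b′ | ∈-irrelevant x∈B x∈B′
    ...     | refl | refl = refl
    fields-≡ : (λ {B} → P.nonempty {B}) ≡ P′.nonempty →
               (λ {B} {B′} {x} → P.disjoint {B} {B′} {x}) ≡ P′.disjoint →
               (λ {B} {x} → P.⊆V {B} {x}) ≡ P′.⊆V →
               (λ {x} → P.cover {x}) ≡ P′.cover → p ≡ p′
    fields-≡ refl refl refl refl = refl

pack-subst : ∀ {F : ℕ → Set} {A B} (e : A ≡ B) (u : F A) →
             _≡_ {A = Σ ℕ F} (B , subst F e u) (A , u)
pack-subst refl u = refl

unpack : ∀ {F : ℕ → Set} {A} {u v : F A} → _≡_ {A = Σ ℕ F} (A , u) (A , v) → u ≡ v
unpack refl = refl

act-cong-packed : ∀ (S : Species) {X Y Y′} (f : Bij X Y) (g : Bij X Y′) → Y ≡ Y′ →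
                  (∀ {x} → x ∈ X → Bij.to f x ≡ Bij.to g x) → ∀ u →
                  _≡_ {A = Σ ℕ (Species.F S)} (Y , Species.act S f u) (Y′ , Species.act S g u)
act-cong-packed S f g refl f≗g u = cong (_ ,_) (Species.act-cong S f g f≗g u)

η̄-at : ∀ {O : ℕ → Set} (η : ∀ {π V} → IsPartitionOf π V → Asm O π → O π → O V)
       {π V σ} (pπ : IsPartitionOf π V) (pσ : IsPartitionOf σ π)
       (a : Asm O π) (b : Asm O σ) {D} (d : D ∈ σ) {B} (q : B ∈ image σ ⋃) → ⋃ D ≡ B →
       _≡_ {A = Σ ℕ O} (B , η̄ η pπ pσ a b B q)
         (⋃ D , η (blockPart pπ pσ d) (λ C c → a C (IsPartitionOf.⊆V pσ d c)) (b D d))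
η̄-at {O} η {σ = σ} pπ pσ a b {D} d {B} q ⋃D≡B =
  let D₀ , d₀ , ⋃D₀≡B = ∈image⁻ {σ} {⋃} q in
  trans (pack-subst {F = O} ⋃D₀≡B _)
        (same-block D₀ d₀ (⋃-injective pπ (IsPartitionOf.⊆V pσ d₀) (IsPartitionOf.⊆V pσ d)
                                          (trans ⋃D₀≡B (sym ⋃D≡B))))
  where
  same-block : ∀ D₀ (d₀ : D₀ ∈ σ) → D₀ ≡ D →
               _≡_ {A = Σ ℕ O}
                 (⋃ D₀ , η (blockPart pπ pσ d₀) (λ C c → a C (IsPartitionOf.⊆V pσ d₀ c)) (b D₀ d₀))
                 (⋃ D , η (blockPart pπ pσ d) (λ C c → a C (IsPartitionOf.⊆V pσ d c)) (b D d))
  same-block _ d₀ refl rewrite ∈-irrelevant d₀ d = refl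

asmImg-at : ∀ (P : Species) {X Y π V} (f : Bij X Y) (V⊆X : V ⊆ X) (p : IsPartitionOf π V)
            (a : Asm (P ⟦_⟧) π) {B′} (q : B′ ∈ image π (imgB f)) →
            Σ ℕ λ B → Σ (B ∈ π) λ b → imgB f B ≡ B′ ×
              _≡_ {A = Σ ℕ (Species.F P)} (B′ , asmImg P f V⊆X p a B′ q)
                (imgB f B , Species.act P (restrictB f (λ x∈ → V⊆X (IsPartitionOf.⊆V p b x∈))) (a B b))
asmImg-at P {π = π} f V⊆X p a q =
  let B , b , fB≡B′ = ∈image⁻ {π} {imgB f} q in
  B , b , fB≡B′ , pack-subst {F = Species.F P} fB≡B′ _

joinAsm-restrict : ∀ {P : ℕ → Set} {π π₀ π₁ π₂} (s : Split π₀ π₁ π₂) (a : Asm P π)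
                   (π₁⊆π : π₁ ⊆ π) (π₂⊆π : π₂ ⊆ π) B (q : B ∈ π₀) (b : B ∈ π) →
                   joinAsm s (restrictAsm π₁⊆π a) (restrictAsm π₂⊆π a) B q ≡ a B b
joinAsm-restrict s a _ _ B q b with Split.cover s q
... | inj₁ _ = cong (a B) (∈-irrelevant _ _)
... | inj₂ _ = cong (a B) (∈-irrelevant _ _)

module CMonopProperties (ext : Extensionality 0ℓ 0ℓ) (C : CMonop) where
  open CMonop C

  infix 4 _≡ᴹ_ _≡ᴼ_ _≡ᴬ_
  _≡ᴹ_ : Σ ℕ (M ⟦_⟧) → Σ ℕ (M ⟦_⟧) → Set
  _≡ᴹ_ = _≡_
  _≡ᴼ_ : Σ ℕ (O ⟦_⟧) → Σ ℕ (O ⟦_⟧) → Set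
  _≡ᴼ_ = _≡_
  _≡ᴬ_ : Σ ℕ (Asm (O ⟦_⟧)) → Σ ℕ (Asm (O ⟦_⟧)) → Set
  _≡ᴬ_ = _≡_

  ν-cong : ∀ {V V′ V₁ V₁′ V₂ V₂′} (s : Split V V₁ V₂) (s′ : Split V′ V₁′ V₂′)
           {m₁ m₂ m₁′ m₂′} → V ≡ V′ → (V₁ , m₁) ≡ᴹ (V₁′ , m₁′) → (V₂ , m₂) ≡ᴹ (V₂′ , m₂′) →
           (V , ν s m₁ m₂) ≡ᴹ (V′ , ν s′ m₁′ m₂′)
  ν-cong s s′ refl refl refl rewrite Split-irrelevant ext s s′ = refl

  τ-cong : ∀ {π π′ V V′} (p : IsPartitionOf π V) (p′ : IsPartitionOf π′ V′)
           {a a′ m m′} → V ≡ V′ → (π , a) ≡ᴬ (π′ , a′) → (π , m) ≡ᴹ (π′ , m′) →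
           (V , τ p a m) ≡ᴹ (V′ , τ p′ a′ m′)
  τ-cong p p′ refl refl refl rewrite IsPartitionOf-irrelevant ext p p′ = refl

  η-cong : ∀ {π π′ V V′} (p : IsPartitionOf π V) (p′ : IsPartitionOf π′ V′)
           {a a′ ω ω′} → V ≡ V′ → (π , a) ≡ᴬ (π′ , a′) → (π , ω) ≡ᴼ (π′ , ω′) →
           (V , η p a ω) ≡ᴼ (V′ , η p′ a′ ω′)
  η-cong p p′ refl refl refl rewrite IsPartitionOf-irrelevant ext p p′ = refl

  ν-cancel-packed : ∀ {V V′ V₁ V₂ V₂′} (s : Split V V₁ V₂) (s′ : Split V′ V₁ V₂′)
                    {m₁ m₂ m₂′} → V ≡ V′ → V₂ ≡ V₂′ →
                    (V , ν s m₁ m₂) ≡ᴹ (V′ , ν s′ m₁ m₂′) → (V₂ , m₂) ≡ᴹ (V₂′ , m₂′)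
  ν-cancel-packed s s′ refl refl eq rewrite Split-irrelevant ext s s′ =
    cong (_ ,_) (ν-cancel s′ _ _ _ (unpack eq))

  τ-cancel-packed : ∀ {π π′ V V′} (p : IsPartitionOf π V) (p′ : IsPartitionOf π′ V′)
                    {a a′ m m′} → V ≡ V′ → (π , a) ≡ᴬ (π′ , a′) →
                    (V , τ p a m) ≡ᴹ (V′ , τ p′ a′ m′) → (π , m) ≡ᴹ (π′ , m′)
  τ-cancel-packed p p′ refl refl eq rewrite IsPartitionOf-irrelevant ext p p′ =
    cong (_ ,_) (τ-cancel p′ _ _ _ (unpack eq))

  η-cancel-packed : ∀ {π π′ V V′} (p : IsPartitionOf π V) (p′ : IsPartitionOf π′ V′)
                    {a a′ ω ω′} → V ≡ V′ → (π , a) ≡ᴬ (π′ , a′) →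
                    (V , η p a ω) ≡ᴼ (V′ , η p′ a′ ω′) → (π , ω) ≡ᴼ (π′ , ω′)
  η-cancel-packed p p′ refl refl eq rewrite IsPartitionOf-irrelevant ext p p′ =
    cong (_ ,_) (η-cancel p′ _ _ _ (unpack eq))

  ν-assoc-∪ : ∀ {V V₁₂ V₃ V₁ V₂} (s : Split V V₁₂ V₃) (s₁₂ : Split V₁₂ V₁ V₂)
              (m₁ : M ⟦ V₁ ⟧) (m₂ : M ⟦ V₂ ⟧) (m₃ : M ⟦ V₃ ⟧) →
              (V , ν s (ν s₁₂ m₁ m₂) m₃)
                ≡ᴹ (V₁ ∪ (V₂ ∪ V₃) , ν (splitUnion (Split-disjoint₁,₂₃ s s₁₂)) m₁
                                        (ν (splitUnion (Split-disjoint₂₃ s s₁₂)) m₂ m₃))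
  ν-assoc-∪ {V} {V₃ = V₃} {V₁} {V₂} s s₁₂ m₁ m₂ m₃ =
    trans (cong (V ,_) (ν-assoc s s₁₂ s₁,₂₃ (splitUnion (Split-disjoint₂₃ s s₁₂)) m₁ m₂ m₃))
          (ν-cong s₁,₂₃ _ (Split-≡∪∪ s s₁₂) refl refl)
    where
    s₁,₂₃ : Split V V₁ (V₂ ∪ V₃)
    s₁,₂₃ = subst (λ W → Split W V₁ (V₂ ∪ V₃)) (sym (Split-≡∪∪ s s₁₂))
                  (splitUnion (Split-disjoint₁,₂₃ s s₁₂))

  M∅-unique : ∀ {W} (m : M ⟦ W ⟧) → W ≡ ∅ → (W , m) ≡ᴹ (∅ , 𝔢)
  M∅-unique m refl = cong (∅ ,_) (M∅-single m)

  O-singleton-unique : ∀ {B v} (o o′ : O ⟦ B ⟧) → B ≡ ⟨ v ⟩ → o ≡ o′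
  O-singleton-unique {v = v} o o′ refl = trans (O-singleton v o) (sym (O-singleton v o′))

  singleton-blocks⇒≡idAsm : ∀ {π W} (p : IsPartitionOf π W) (a : Asm (O ⟦_⟧) π) →
                            (∀ {B} → B ∈ π → Σ ℕ (λ v → B ≡ ⟨ v ⟩)) → (π , a) ≡ᴬ idAsm C W
  singleton-blocks⇒≡idAsm p a singleton =
    Asm-≡ ext (singleton-blocks⇒≡singletons p singleton) λ B b _ →
      O-singleton-unique {v = proj₁ (singleton b)} _ _ (proj₂ (singleton b))

  ρ̄-asm-at : ∀ {V} (x : MEO M O V) (y : MEO M O (MEO.part x)) {D} (d : D ∈ MEO.part y)
             {B} (q : B ∈ MEO.part (ρ̄ C x y)) → ⋃ D ≡ B →
             (B , MEO.asm (ρ̄ C x y) B q)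
               ≡ᴼ (⋃ D , η (blockPart (subPartition (MEO.isPart x) (Split.inr (MEO.split y)))
                                      (MEO.isPart y) d)
                           (λ B′ b′ → MEO.asm x B′ (Split.inr (MEO.split y)
                                                      (IsPartitionOf.⊆V (MEO.isPart y) d b′)))
                           (MEO.asm y D d))
  ρ̄-asm-at x y =
    η̄-at η (subPartition (MEO.isPart x) (Split.inr (MEO.split y))) (MEO.isPart y)
         (restrictAsm (Split.inr (MEO.split y)) (MEO.asm x)) (MEO.asm y)

  τ-restrict-∪ : ∀ {π V π₁ π₂} (p : IsPartitionOf π V) (a : Asm (O ⟦_⟧) π)
                 (π₁⊆π : π₁ ⊆ π) (π₂⊆π : π₂ ⊆ π) (π₁₂⊆π : π₁ ∪ π₂ ⊆ π)
                 (π₁#π₂ : Disjoint π₁ π₂) (m₁ : M ⟦ π₁ ⟧) (m₂ : M ⟦ π₂ ⟧) →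
                 (⋃ π₁ ∪ ⋃ π₂ , ν (splitUnion (⋃-Disjoint p π₁⊆π π₂⊆π π₁#π₂))
                                   (τ (subPartition p π₁⊆π) (restrictAsm π₁⊆π a) m₁)
                                   (τ (subPartition p π₂⊆π) (restrictAsm π₂⊆π a) m₂))
                   ≡ᴹ (⋃ (π₁ ∪ π₂) , τ (subPartition p π₁₂⊆π) (restrictAsm π₁₂⊆π a)
                                        (ν (splitUnion π₁#π₂) m₁ m₂))
  τ-restrict-∪ {π₁ = π₁} {π₂} p a π₁⊆π π₂⊆π π₁₂⊆π π₁#π₂ m₁ m₂ =
    trans (ν-cong _ s (sym (⋃-∪ π₁ π₂)) refl refl)
      (trans (cong (_ ,_) (compat s (splitUnion π₁#π₂) (subPartition p π₁⊆π) (subPartition p π₂⊆π)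
                                  (subPartition p π₁₂⊆π) _ _ m₁ m₂))
             (τ-cong _ _ refl (Asm-≡ ext refl joined) refl))
    where
    s : Split (⋃ (π₁ ∪ π₂)) (⋃ π₁) (⋃ π₂)
    s = subst (λ W → Split W (⋃ π₁) (⋃ π₂)) (sym (⋃-∪ π₁ π₂))
              (splitUnion (⋃-Disjoint p π₁⊆π π₂⊆π π₁#π₂))
    joined : ∀ B (b b′ : B ∈ π₁ ∪ π₂) →
             joinAsm (splitUnion π₁#π₂) (restrictAsm π₁⊆π a) (restrictAsm π₂⊆π a) B b
               ≡ a B (π₁₂⊆π b′)
    joined B b b′ = joinAsm-restrict (splitUnion π₁#π₂) a π₁⊆π π₂⊆π B b (π₁₂⊆π b′)

  ρ̄-asm-restrict : ∀ {V} (x : MEO M O V) (y : MEO M O (MEO.part x)) {ς₁}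
                   (ς₁⊆ς : ς₁ ⊆ MEO.part y) (⋃ς₁⊆π : ⋃ ς₁ ⊆ MEO.part x)
                   B (b : B ∈ MEO.part (ρ̄ C x y)) (b′ : B ∈ image ς₁ ⋃) →
                   MEO.asm (ρ̄ C x y) B b
                     ≡ η̄ η (subPartition (MEO.isPart x) ⋃ς₁⊆π) (subPartition (MEO.isPart y) ς₁⊆ς)
                          (restrictAsm ⋃ς₁⊆π (MEO.asm x)) (restrictAsm ς₁⊆ς (MEO.asm y)) B b′
  ρ̄-asm-restrict x y {ς₁} ς₁⊆ς ⋃ς₁⊆π B b b′ =
    let D , d , ⋃D≡B = ∈image⁻ {ς₁} {⋃} b′ in
    unpack (trans (ρ̄-asm-at x y (ς₁⊆ς d) b ⋃D≡B)
             (trans (η-cong _ _ refl (Asm-≡ ext refl λ B′ _ _ → cong (MEO.asm x B′) (∈-irrelevant _ _)) refl)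
                    (sym (η̄-at η (subPartition (MEO.isPart x) ⋃ς₁⊆π) (subPartition (MEO.isPart y) ς₁⊆ς)
                               (restrictAsm ⋃ς₁⊆π (MEO.asm x)) (restrictAsm ς₁⊆ς (MEO.asm y))
                               d b′ ⋃D≡B))))

  τ-restrict-ρ̄ : ∀ {V} (x : MEO M O V) (y : MEO M O (MEO.part x)) {ς₁}
                 (ς₁⊆ς : ς₁ ⊆ MEO.part y) (⋃ς₁⊆π : ⋃ ς₁ ⊆ MEO.part x)
                 (sub : image ς₁ ⋃ ⊆ MEO.part (ρ̄ C x y))
                 (g : Bij ς₁ (image ς₁ ⋃)) → (∀ {D} → D ∈ ς₁ → Bij.to g D ≡ ⋃ D) →
                 (m : M ⟦ ς₁ ⟧) →
                 (⋃ (image ς₁ ⋃) , τ (subPartition (MEO.isPart (ρ̄ C x y)) sub)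
                                      (restrictAsm sub (MEO.asm (ρ̄ C x y))) (Species.act M g m))
                   ≡ᴹ (⋃ (⋃ ς₁) , τ (subPartition (MEO.isPart x) ⋃ς₁⊆π) (restrictAsm ⋃ς₁⊆π (MEO.asm x))
                                     (τ (subPartition (MEO.isPart y) ς₁⊆ς)
                                        (restrictAsm ς₁⊆ς (MEO.asm y)) m))
  τ-restrict-ρ̄ x y {ς₁} ς₁⊆ς ⋃ς₁⊆π sub g g≗⋃ m =
    trans (τ-cong _ (etaBarPart p₂ p₁) (⋃-image-⋃ ς₁)
                  (Asm-≡ ext refl λ B b b′ → ρ̄-asm-restrict x y ς₁⊆ς ⋃ς₁⊆π B (sub b) b′)
                  (act-cong-packed M g (φ p₂ p₁) refl g≗⋃ m))
          (cong (_ ,_) (τ-assoc p₂ p₁ _ _ m))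
    where
    p₁ : IsPartitionOf ς₁ (⋃ ς₁)
    p₁ = subPartition (MEO.isPart y) ς₁⊆ς
    p₂ : IsPartitionOf (⋃ ς₁) (⋃ (⋃ ς₁))
    p₂ = subPartition (MEO.isPart x) ⋃ς₁⊆π

  module Associativity {V} (x : MEO M O V) (y : MEO M O (MEO.part x))
                       (z : MEO M O (MEO.part y)) where
    private
      module X = MEO x
      module Y = MEO y
      module Z = MEO z
      module XY = MEO (ρ̄ C x y)
      module YZ = MEO (ρ̄ C y z)
      module Z′ = MEO (actMEO (ident C x y) z)

    L R : MEO M O V
    L = ρ̄ C (ρ̄ C x y) (actMEO (ident C x y) z)
    R = ρ̄ C x (ρ̄ C y z)

    ⋃ς₁⊆π : ⋃ Z.V₁ ⊆ X.part
    ⋃ς₁⊆π q = Split.inr Y.split (⋃-⊆ Y.isPart (Split.inl Z.split) q)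

    private
      sᴸ : Split (MEO.V₁ L) XY.V₁ (⋃ Z′.V₁)
      sᴸ = splitUnion (disjρ XY.split XY.isPart Z′.split)
      sˣʸ : Split XY.V₁ X.V₁ (⋃ Y.V₁)
      sˣʸ = splitUnion (disjρ X.split X.isPart Y.split)
      m₂′ : M ⟦ ⋃ Y.V₁ ⟧
      m₂′ = τ (subPartition X.isPart (Split.inl Y.split)) (restrictAsm (Split.inl Y.split) X.asm) Y.m
      m₃′ : M ⟦ ⋃ Z′.V₁ ⟧
      m₃′ = τ (subPartition XY.isPart (Split.inl Z′.split)) (restrictAsm (Split.inl Z′.split) XY.asm) Z′.m
      m₂₃′ : M ⟦ ⋃ YZ.V₁ ⟧
      m₂₃′ = τ (subPartition X.isPart (Split.inl YZ.split)) (restrictAsm (Split.inl YZ.split) X.asm) YZ.m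

    τ-middle : (⋃ Y.V₁ ∪ ⋃ Z′.V₁ , ν (splitUnion (Split-disjoint₂₃ sᴸ sˣʸ)) m₂′ m₃′) ≡ᴹ (⋃ YZ.V₁ , m₂₃′)
    τ-middle =
      trans (ν-cong _ _ (cong (⋃ Y.V₁ ∪_) (⋃-image-⋃ Z.V₁)) refl
                    (τ-restrict-ρ̄ x y (Split.inl Z.split) ⋃ς₁⊆π (Split.inl Z′.split)
                                   (restrictB (ident C x y) (Split.inl Z.split)) (λ _ → refl) Z.m))
            (τ-restrict-∪ X.isPart X.asm (Split.inl Y.split) ⋃ς₁⊆π (Split.inl YZ.split)
                          (disjρ Y.split Y.isPart Z.split) Y.m _)

    Mpart-assoc : Mpart C L ≡ Mpart C R
    Mpart-assoc = trans (ν-assoc-∪ sᴸ sˣʸ X.m m₂′ m₃′)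
                        (ν-cong _ _ (cong (X.V₁ ∪_) (cong proj₁ τ-middle)) refl τ-middle)

    parts-assoc : MEO.part L ≡ MEO.part R
    parts-assoc = trans (image-∘ Z.part (imgB (ident C x y)) ⋃)
                   (trans (image-cong Z.part _ _ (λ {D} _ → ⋃-image-⋃ D))
                          (sym (image-∘ Z.part ⋃ ⋃)))

    module Block {D} (d : D ∈ Z.part) where
      d⋃ : ⋃ D ∈ YZ.part
      d⋃ = ∈image⁺ {Z.part} {⋃} d
      D⊆ς : D ⊆ Y.part
      D⊆ς c = Split.inr Z.split (IsPartitionOf.⊆V Z.isPart d c)
      ⋃D⊆π : ⋃ D ⊆ X.part
      ⋃D⊆π b = Split.inr YZ.split (IsPartitionOf.⊆V YZ.isPart d⋃ b)
      p₁ : IsPartitionOf D (⋃ D)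
      p₁ = subPartition Y.isPart D⊆ς
      p₂ : IsPartitionOf (⋃ D) (⋃ (⋃ D))
      p₂ = subPartition X.isPart ⋃D⊆π

      -- both sides of the associativity law take this value on the block ⋃ ⋃ D
      assoc-block : Σ ℕ (O ⟦_⟧)
      assoc-block = ⋃ (⋃ D) , η p₂ (restrictAsm ⋃D⊆π X.asm) (η p₁ (restrictAsm D⊆ς Y.asm) (Z.asm D d))

      blockᴿ : ∀ {B} (b : B ∈ MEO.part R) → ⋃ (⋃ D) ≡ B → (B , MEO.asm R B b) ≡ᴼ assoc-block
      blockᴿ b ⋃⋃D≡B =
        trans (ρ̄-asm-at x (ρ̄ C y z) d⋃ b ⋃⋃D≡B)
              (cong (λ ω → ⋃ (⋃ D) , η p₂ (restrictAsm ⋃D⊆π X.asm) ω) (unpack (ρ̄-asm-at y z d d⋃ refl)))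

      blockᴸ : ∀ {E B} (e : E ∈ Z′.part) (b : B ∈ MEO.part L) → image D ⋃ ≡ E → ⋃ E ≡ B →
               (f : Bij D (image D ⋃)) → (∀ {C} → C ∈ D → Bij.to f C ≡ ⋃ C) →
               (E , Z′.asm E e) ≡ᴼ (image D ⋃ , Species.act O f (Z.asm D d)) →
               (B , MEO.asm L B b) ≡ᴼ assoc-block
      blockᴸ e b D⋃≡E ⋃E≡B f f≗⋃ z′-block =
        trans (ρ̄-asm-at (ρ̄ C x y) (actMEO (ident C x y) z) e b ⋃E≡B)
          (trans (η-cong _ (etaBarPart p₂ p₁) (trans (cong ⋃ (sym D⋃≡E)) (⋃-image-⋃ D))
                         (Asm-≡ ext (sym D⋃≡E) λ B′ _ b′ → ρ̄-asm-restrict x y D⊆ς ⋃D⊆π B′ _ b′)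
                         (trans z′-block (act-cong-packed O f (φ p₂ p₁) refl f≗⋃ (Z.asm D d))))
                 (cong (⋃ (⋃ D) ,_) (η-assoc p₂ p₁ _ _ (Z.asm D d))))

    blocks-assoc : ∀ {B} (bᴸ : B ∈ MEO.part L) (bᴿ : B ∈ MEO.part R) →
                   MEO.asm L B bᴸ ≡ MEO.asm R B bᴿ
    blocks-assoc bᴸ bᴿ =
      let E , e , ⋃E≡B = ∈image⁻ {Z′.part} {⋃} bᴸ
          D , d , D⋃≡E , z′-block = asmImg-at O (ident C x y) (Split.inr Z.split) Z.isPart Z.asm e
          atᴸ = Block.blockᴸ d e bᴸ D⋃≡E ⋃E≡B _ (λ _ → refl) z′-block
      in unpack (trans atᴸ (sym (Block.blockᴿ d bᴿ (sym (cong proj₁ atᴸ)))))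

    Epart-assoc : Epart C L ≡ Epart C R
    Epart-assoc = Asm-≡ ext parts-assoc λ B bᴸ bᴿ → blocks-assoc bᴸ bᴿ

  ρ̄-cancelˡ : ∀ {V} (x : MEO M O V) (y y′ : MEO M O (MEO.part x)) →
              _≈_ C (ρ̄ C x y) (ρ̄ C x y′) → _≈_ C y y′
  ρ̄-cancelˡ x y y′ (ρ̄ᴹ-≡ , ρ̄ᴱ-≡) = Mpart-≡ , Epart-≡
    where
    module X = MEO x
    module Y = MEO y
    module Y′ = MEO y′
    ⋃π₁-≡ : ⋃ Y.V₁ ≡ ⋃ Y′.V₁
    ⋃π₁-≡ = ∪-cancelˡ {X.V₁} (disjρ X.split X.isPart Y.split) (disjρ X.split X.isPart Y′.split)
                      (cong proj₁ ρ̄ᴹ-≡)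
    π₁-≡ : Y.V₁ ≡ Y′.V₁
    π₁-≡ = ⋃-injective X.isPart (Split.inl Y.split) (Split.inl Y′.split) ⋃π₁-≡
    Mpart-≡ : Mpart C y ≡ Mpart C y′
    Mpart-≡ = τ-cancel-packed _ _ ⋃π₁-≡ (Asm-≡ ext π₁-≡ λ B _ _ → cong (X.asm B) (∈-irrelevant _ _))
                              (ν-cancel-packed _ _ (cong proj₁ ρ̄ᴹ-≡) ⋃π₁-≡ ρ̄ᴹ-≡)
    ς-≡ : Y.part ≡ Y′.part
    ς-≡ = image-⋃-injective X.isPart
            (λ d c → Split.inr Y.split (IsPartitionOf.⊆V Y.isPart d c))
            (λ d c → Split.inr Y′.split (IsPartitionOf.⊆V Y′.isPart d c))
            (cong proj₁ ρ̄ᴱ-≡)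
    blocks-≡ : ∀ D (d : D ∈ Y.part) (d′ : D ∈ Y′.part) → Y.asm D d ≡ Y′.asm D d′
    blocks-≡ D d d′ =
      unpack (η-cancel-packed _ _ refl (Asm-≡ ext refl λ B _ _ → cong (X.asm B) (∈-irrelevant _ _))
        (trans (sym (ρ̄-asm-at x y d (∈image⁺ {Y.part} {⋃} d) refl))
          (trans (cong (⋃ D ,_) (Asm-≡⁻ ρ̄ᴱ-≡ (⋃ D) _ _))
                 (ρ̄-asm-at x y′ d′ (∈image⁺ {Y′.part} {⋃} d′) refl))))
    Epart-≡ : Epart C y ≡ Epart C y′
    Epart-≡ = Asm-≡ ext ς-≡ blocks-≡

  ρ̄-unit-divisors : ∀ {V} (x : MEO M O V) (y : MEO M O (MEO.part x)) →
                    Mpart C (ρ̄ C x y) ≡ unitM C → Epart C (ρ̄ C x y) ≡ idAsm C V →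
                    (Mpart C x ≡ unitM C) × (Mpart C y ≡ unitM C)
                    × (Epart C x ≡ idAsm C (MEO.V₂ x)) × (Epart C y ≡ idAsm C (MEO.V₂ y))
  ρ̄-unit-divisors {V} x y ρ̄ᴹ-≡ ρ̄ᴱ-≡ =
      M∅-unique X.m V₁-≡∅
    , M∅-unique Y.m π₁-≡∅
    , singleton-blocks⇒≡idAsm X.isPart X.asm π-singletons
    , singleton-blocks⇒≡idAsm Y.isPart Y.asm ς-singletons
    where
    module X = MEO x
    module Y = MEO y
    V₁-≡∅ : X.V₁ ≡ ∅
    V₁-≡∅ = proj₁ (∪-≡∅ {X.V₁} {⋃ Y.V₁} (cong proj₁ ρ̄ᴹ-≡))
    π₁-≡∅ : Y.V₁ ≡ ∅
    π₁-≡∅ = ⋃-≡∅ X.isPart (Split.inl Y.split) (proj₂ (∪-≡∅ {X.V₁} {⋃ Y.V₁} (cong proj₁ ρ̄ᴹ-≡)))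
    ⋃-singleton : ∀ {D} → D ∈ Y.part → Σ ℕ (λ v → ⋃ D ≡ ⟨ v ⟩)
    ⋃-singleton {D} d with ∈image⁻ {V} {⟨_⟩} (subst (⋃ D ∈_) (cong proj₁ ρ̄ᴱ-≡) (∈image⁺ {Y.part} {⋃} d))
    ... | v , _ , ⟨v⟩≡⋃D = v , sym ⟨v⟩≡⋃D
    block-≡⟨⟩ : ∀ {D B} (d : D ∈ Y.part) → B ∈ D → B ≡ ⟨ proj₁ (⋃-singleton d) ⟩
    block-≡⟨⟩ d b =
      ⊆⟨⟩⇒≡⟨⟩ (IsPartitionOf.nonempty X.isPart (Split.inr Y.split (IsPartitionOf.⊆V Y.isPart d b)))
              (λ u∈B → ∈⟨⟩⁻ {proj₁ (⋃-singleton d)} (subst (_ ∈_) (proj₂ (⋃-singleton d)) (∈⋃⁺ b u∈B)))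
    π-singletons : ∀ {B} → B ∈ X.part → Σ ℕ (λ v → B ≡ ⟨ v ⟩)
    π-singletons b with Split.cover Y.split b
    ... | inj₁ b₁ = ⊥-elim (≡∅⇒∉ π₁-≡∅ b₁)
    ... | inj₂ b₂ = let D , d , b∈D = IsPartitionOf.cover Y.isPart b₂ in
                    proj₁ (⋃-singleton d) , block-≡⟨⟩ d b∈D
    ς-singletons : ∀ {D} → D ∈ Y.part → Σ ℕ (λ u → D ≡ ⟨ u ⟩)
    ς-singletons d = ⟨ proj₁ (⋃-singleton d) ⟩ , ⊆⟨⟩⇒≡⟨⟩ (IsPartitionOf.nonempty Y.isPart d) (block-≡⟨⟩ d)

theorem7p1 :
  Extensionality 0ℓ 0ℓ →
  (C : CMonop) →
  ∀ {V} (x : MEO (CMonop.M C) (CMonop.O C) V)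
    (y : MEO (CMonop.M C) (CMonop.O C) (MEO.part x))
    (z : MEO (CMonop.M C) (CMonop.O C) (MEO.part y)) →
    -- (1) associativity
    _≈_ C (ρ̄ C (ρ̄ C x y) (actMEO (ident C x y) z)) (ρ̄ C x (ρ̄ C y z))
    -- (2) left cancellation
    × (∀ (y′ : MEO (CMonop.M C) (CMonop.O C) (MEO.part x)) →
         _≈_ C (ρ̄ C x y) (ρ̄ C x y′) → _≈_ C y y′)
    -- (3) no proper divisors of the identity
    × (Mpart C (ρ̄ C x y) ≡ unitM C →
       Epart C (ρ̄ C x y) ≡ idAsm C V →
       (Mpart C x ≡ unitM C) × (Mpart C y ≡ unitM C)
       × (Epart C x ≡ idAsm C (MEO.V₂ x)) × (Epart C y ≡ idAsm C (MEO.V₂ y)))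
theorem7p1 ext C x y z =
  (Mpart-assoc , Epart-assoc) , ρ̄-cancelˡ x y , ρ̄-unit-divisors x y
  where
  open CMonopProperties ext C
  open Associativity x y z
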